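{- Let $c$ be a positive integer and let $(L,Q_1,\ldots,Q_n,R)$ be a $(4,c)$-flexipath in a matroid $M$. If $n\ge 3$, then $c\le 2$.
   Context: Let $M$ be a matroid on ground set $E$ with rank function $r$. $\lambda(A)=r(A)+r(E-A)-r(M)$; $\kappa(X,Y)=\min\{\lambda(Z):X\subseteq Z\subseteq E-Y\}$ for disjoint $X,Y$. A path of $4$-separations is an ordered partition $(L,P_1,\ldots,P_n,R)$ of $E$ with $\kappa(L,R)=3$ and $\lambda(L\cup P_1\cup\cdots\cup P_i)=3$ for all $i\in\{0,\ldots,n\}$; a $4$-flexipath if this holds for every reordering of $P_1,\ldots,P_n$ (with $L,R$ fixed); a $(4,c)$-flexipath if moreover $\lambda(P_i)=c$ for all $i$ and $\lambda(P_i\cup P_j)>c$ for all distinct $i,j$. -}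

module Defs where

open import Data.Nat using (ℕ; zero; suc; _+_; _∸_; _≤_; _<_; _<ᵇ_)
open import Data.Fin using (Fin; toℕ)
open import Data.Fin.Subset using (Subset; _∪_; _∩_; ∁; _⊆_; ∣_∣; ⊤; inside; outside)
open import Data.Fin.Permutation using (Permutation′; _⟨$⟩ˡ_)
open import Data.Vec using (tabulate)
open import Data.Bool using (if_then_else_)
open import Data.Product using (Σ; _×_; _,_)
open import Relation.Binary.PropositionalEquality using (_≡_; _≢_)

record Matroid : Set where
  field
    size        : ℕ
    r           : Subset size → ℕ
    r-bounded   : ∀ X → r X ≤ ∣ X ∣
    r-monotone  : ∀ X Y → X ⊆ Y → r X ≤ r Y
    r-submod    : ∀ X Y → r (X ∪ Y) + r (X ∩ Y) ≤ r X + r Y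

module _ (M : Matroid) where
  open Matroid M

  rM : ℕ
  rM = r ⊤

  -- connectivity function λ(A) = r(A) + r(E - A) - r(M)
  -- (truncated subtraction is harmless: the quantity is always ≥ 0 by submodularity)
  conn : Subset size → ℕ
  conn A = (r A + r (∁ A)) ∸ rM

  KappaIs : Subset size → Subset size → ℕ → Set
  KappaIs X Y k =
    Σ (Subset size) (λ Z → X ⊆ Z × Z ⊆ ∁ Y × conn Z ≡ k)
    × (∀ Z → X ⊆ Z → Z ⊆ ∁ Y → k ≤ conn Z)

-- Labels of an ordered partition (L, P_1, ..., P_n, R)
data Label (n : ℕ) : Set where
  lab-L : Label n
  lab-P : Fin n → Label n
  lab-R : Label n

module _ (M : Matroid) {n : ℕ} (part : Fin (Matroid.size M) → Label n) where
  open Matroid M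

  blockL : Subset size
  blockL = tabulate λ e → isL (part e)
    where
    isL : Label n → _
    isL lab-L     = inside
    isL (lab-P _) = outside
    isL lab-R     = outside

  blockR : Subset size
  blockR = tabulate λ e → isR (part e)
    where
    isR : Label n → _
    isR lab-L     = outside
    isR (lab-P _) = outside
    isR lab-R     = inside

  blockP : Fin n → Subset size
  blockP j = tabulate λ e → isP (part e)
    where
    isP : Label n → _
    isP lab-L     = outside
    isP (lab-P k) = if toℕ k Data.Nat.≡ᵇ toℕ j then inside else outside
    isP lab-R     = outside

  -- L ∪ P_{σ(1)} ∪ ... ∪ P_{σ(i)}  (blocks taken in the order σ(1), σ(2), ...)
  prefix : Permutation′ n → ℕ → Subset size
  prefix σ i = tabulate λ e → inPre (part e)
    where
    inPre : Label n → _
    inPre lab-L     = inside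
    inPre (lab-P k) = if toℕ (σ ⟨$⟩ˡ k) <ᵇ i then inside else outside
    inPre lab-R     = outside

  IsPath4 : Permutation′ n → Set
  IsPath4 σ = KappaIs M blockL blockR 3
            × (∀ i → i ≤ n → conn M (prefix σ i) ≡ 3)

  Is4Flexipath : Set
  Is4Flexipath = ∀ (σ : Permutation′ n) → IsPath4 σ

  Is4cFlexipath : ℕ → Set
  Is4cFlexipath c = Is4Flexipath
                  × (∀ j → conn M (blockP j) ≡ c)
                  × (∀ j k → j ≢ k → c < conn M (blockP j ∪ blockP k))

-- Index the blocks from 0 and put X = L ∪ P₀ ∪ P₁ and Y = L ∪ P₂. Each is a prefix of
-- some reordering of the flexipath, so λ(X) = λ(Y) = 3. Since X − Y = P₀ ∪ P₁ and
-- Y − X = P₂, posimodularity of λ (submodularity applied to X and E − Y) gives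
-- (c + 1) + c ≤ λ(P₀ ∪ P₁) + λ(P₂) ≤ λ(X) + λ(Y) = 6, hence c ≤ 2.
module Submission where

open import Defs
open import Data.Nat using (ℕ; _≤_)
open import Data.Fin using (Fin)

import Algebra.Lattice.Properties.BooleanAlgebra
import Algebra.Properties.CommutativeSemigroup
open import Data.Bool using (Bool; not; _∧_; _∨_)
open import Data.Fin using (zero; suc; #_)
open import Data.Fin.Permutation using (id; transpose)
open import Data.Fin.Subset using (Subset; _∪_; _∩_; ∁)
open import Data.Fin.Subset.Properties using (p∪∁p≡⊤; ∩-comm; ∪-∩-booleanAlgebra)
open import Data.Nat using (_+_; _∸_; _<_; z≤n; s≤s)
open import Data.Nat.Properties
  using (+-comm; +-mono-≤; +-cancelʳ-≤; m≤m+n; m∸n+n≡m; +-mono-<-≤; <⇒≱; ≮⇒≥; ≤-reflexive;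
         +-commutativeSemigroup; module ≤-Reasoning)
open import Data.Product using (_,_; proj₂)
open import Data.Vec using (_∷_; tabulate; zipWith)
open import Data.Vec.Properties using (tabulate-cong; tabulate-∘)
open import Function using (_∘_)
open import Relation.Binary.PropositionalEquality using (_≡_; refl; sym; trans; cong; cong₂; module ≡-Reasoning)

zipWith-tabulate : ∀ {a b c} {A : Set a} {B : Set b} {C : Set c} {n}
                   (_∙_ : A → B → C) (f : Fin n → A) (g : Fin n → B) →
                   zipWith _∙_ (tabulate f) (tabulate g) ≡ tabulate (λ i → f i ∙ g i)
zipWith-tabulate {n = ℕ.zero}  _∙_ f g = refl
zipWith-tabulate {n = ℕ.suc n} _∙_ f g = cong (f zero ∙ g zero ∷_) (zipWith-tabulate _∙_ (f ∘ suc) (g ∘ suc))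

tabulate-∩-∁ : ∀ {n} (f g : Fin n → Bool) → tabulate f ∩ ∁ (tabulate g) ≡ tabulate (λ i → f i ∧ not (g i))
tabulate-∩-∁ f g = trans (cong (tabulate f ∩_) (sym (tabulate-∘ not g))) (zipWith-tabulate _∧_ f (not ∘ g))

c+c<6⇒c≤2 : ∀ c → c + c < 6 → c ≤ 2
c+c<6⇒c≤2 c c+c<6 = ≮⇒≥ λ 3≤c → <⇒≱ c+c<6 (+-mono-≤ 3≤c 3≤c)

module Connectivity (M : Matroid) where
  open Matroid M
  open Algebra.Lattice.Properties.BooleanAlgebra (∪-∩-booleanAlgebra size)
    using (deMorgan₁; deMorgan₂; ¬-involutive)
  open Algebra.Properties.CommutativeSemigroup +-commutativeSemigroup using (interchange)

  conn+rM≡r+r∁ : ∀ A → conn M A + rM M ≡ r A + r (∁ A)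
  conn+rM≡r+r∁ A = m∸n+n≡m rM≤r+r∁
    where
    rM≤r+r∁ : rM M ≤ r A + r (∁ A)
    rM≤r+r∁ = begin
      rM M                         ≡⟨ cong r (sym (p∪∁p≡⊤ A)) ⟩
      r (A ∪ ∁ A)                  ≤⟨ m≤m+n _ _ ⟩
      r (A ∪ ∁ A) + r (A ∩ ∁ A)    ≤⟨ r-submod A (∁ A) ⟩
      r A + r (∁ A)                ∎
      where open ≤-Reasoning

  conn-∁ : ∀ A → conn M (∁ A) ≡ conn M A
  conn-∁ A = cong (_∸ rM M) (begin
    r (∁ A) + r (∁ (∁ A))  ≡⟨ cong (λ B → r (∁ A) + r B) (¬-involutive A) ⟩
    r (∁ A) + r A          ≡⟨ +-comm (r (∁ A)) (r A) ⟩
    r A + r (∁ A)          ∎)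
    where open ≡-Reasoning

  r+r∁-submodular : ∀ X Y → (r (X ∪ Y) + r (∁ (X ∪ Y))) + (r (X ∩ Y) + r (∁ (X ∩ Y)))
                          ≤ (r X + r (∁ X)) + (r Y + r (∁ Y))
  r+r∁-submodular X Y = begin
    (r (X ∪ Y) + r (∁ (X ∪ Y))) + (r (X ∩ Y) + r (∁ (X ∩ Y)))
      ≡⟨ interchange (r (X ∪ Y)) _ _ _ ⟩
    (r (X ∪ Y) + r (X ∩ Y)) + (r (∁ (X ∪ Y)) + r (∁ (X ∩ Y)))
      ≡⟨ cong ((r (X ∪ Y) + r (X ∩ Y)) +_) (+-comm (r (∁ (X ∪ Y))) _) ⟩
    (r (X ∪ Y) + r (X ∩ Y)) + (r (∁ (X ∩ Y)) + r (∁ (X ∪ Y)))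
      ≡⟨ cong ((r (X ∪ Y) + r (X ∩ Y)) +_) (cong₂ (λ A B → r A + r B) (deMorgan₁ X Y) (deMorgan₂ X Y)) ⟩
    (r (X ∪ Y) + r (X ∩ Y)) + (r (∁ X ∪ ∁ Y) + r (∁ X ∩ ∁ Y))
      ≤⟨ +-mono-≤ (r-submod X Y) (r-submod (∁ X) (∁ Y)) ⟩
    (r X + r Y) + (r (∁ X) + r (∁ Y))
      ≡⟨ interchange (r X) _ _ _ ⟩
    (r X + r (∁ X)) + (r Y + r (∁ Y)) ∎
    where open ≤-Reasoning

  conn-submodular : ∀ X Y → conn M (X ∪ Y) + conn M (X ∩ Y) ≤ conn M X + conn M Y
  conn-submodular X Y = +-cancelʳ-≤ (rM M + rM M) _ _ (begin
    (conn M (X ∪ Y) + conn M (X ∩ Y)) + (rM M + rM M)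
      ≡⟨ interchange (conn M (X ∪ Y)) _ _ _ ⟩
    (conn M (X ∪ Y) + rM M) + (conn M (X ∩ Y) + rM M)
      ≡⟨ cong₂ _+_ (conn+rM≡r+r∁ (X ∪ Y)) (conn+rM≡r+r∁ (X ∩ Y)) ⟩
    (r (X ∪ Y) + r (∁ (X ∪ Y))) + (r (X ∩ Y) + r (∁ (X ∩ Y)))
      ≤⟨ r+r∁-submodular X Y ⟩
    (r X + r (∁ X)) + (r Y + r (∁ Y))
      ≡⟨ cong₂ _+_ (conn+rM≡r+r∁ X) (conn+rM≡r+r∁ Y) ⟨
    (conn M X + rM M) + (conn M Y + rM M)
      ≡⟨ interchange (conn M X) _ _ _ ⟩
    (conn M X + conn M Y) + (rM M + rM M) ∎)
    where open ≤-Reasoning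

  conn-posimodular : ∀ X Y → conn M (X ∩ ∁ Y) + conn M (Y ∩ ∁ X) ≤ conn M X + conn M Y
  conn-posimodular X Y = begin
    conn M (X ∩ ∁ Y) + conn M (Y ∩ ∁ X)        ≡⟨ cong (conn M (X ∩ ∁ Y) +_) conn-Y∖X≡conn-X∪∁Y ⟩
    conn M (X ∩ ∁ Y) + conn M (X ∪ ∁ Y)        ≡⟨ +-comm (conn M (X ∩ ∁ Y)) _ ⟩
    conn M (X ∪ ∁ Y) + conn M (X ∩ ∁ Y)        ≤⟨ conn-submodular X (∁ Y) ⟩
    conn M X + conn M (∁ Y)                    ≡⟨ cong (conn M X +_) (conn-∁ Y) ⟩
    conn M X + conn M Y                        ∎
    where
    open ≤-Reasoning
    conn-Y∖X≡conn-X∪∁Y : conn M (Y ∩ ∁ X) ≡ conn M (X ∪ ∁ Y)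
    conn-Y∖X≡conn-X∪∁Y = begin-equality
      conn M (Y ∩ ∁ X)          ≡⟨ cong (conn M) (∩-comm Y (∁ X)) ⟩
      conn M (∁ X ∩ Y)          ≡⟨ cong (λ B → conn M (∁ X ∩ B)) (¬-involutive Y) ⟨
      conn M (∁ X ∩ ∁ (∁ Y))    ≡⟨ cong (conn M) (deMorgan₂ X (∁ Y)) ⟨
      conn M (∁ (X ∪ ∁ Y))      ≡⟨ conn-∁ (X ∪ ∁ Y) ⟩
      conn M (X ∪ ∁ Y)          ∎

module FirstThreeBlocks (M : Matroid) {m : ℕ} (part : Fin (Matroid.size M) → Label (3 + m)) where
  open Matroid M using (size)

  P : Fin (3 + m) → Subset size
  P = blockP M part

  L∪P₀∪P₁ : Subset size
  L∪P₀∪P₁ = prefix M part id 2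

  L∪P₂ : Subset size
  L∪P₂ = prefix M part (transpose (# 0) (# 2)) 1

  -- The membership tests inside prefix and blockP are where-local in Defs, so the types
  -- of these case analyses can only be inferred from their uses.
  private
    by-label₁ : ∀ e → _ ≡ _
    by-label₂ : ∀ e → _ ≡ _

  L∪P₀∪P₁∖L∪P₂ : L∪P₀∪P₁ ∩ ∁ L∪P₂ ≡ P (# 0) ∪ P (# 1)
  L∪P₀∪P₁∖L∪P₂ = trans (tabulate-∩-∁ _ _) (trans (tabulate-cong by-label₁) (sym (zipWith-tabulate _∨_ _ _)))

  L∪P₂∖L∪P₀∪P₁ : L∪P₂ ∩ ∁ L∪P₀∪P₁ ≡ P (# 2)
  L∪P₂∖L∪P₀∪P₁ = trans (tabulate-∩-∁ _ _) (tabulate-cong by-label₂)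

  by-label₁ e with part e
  ... | lab-L                      = refl
  ... | lab-R                      = refl
  ... | lab-P zero                 = refl
  ... | lab-P (suc zero)           = refl
  ... | lab-P (suc (suc zero))     = refl
  ... | lab-P (suc (suc (suc _)))  = refl

  by-label₂ e with part e
  ... | lab-L                      = refl
  ... | lab-R                      = refl
  ... | lab-P zero                 = refl
  ... | lab-P (suc zero)           = refl
  ... | lab-P (suc (suc zero))     = refl
  ... | lab-P (suc (suc (suc _)))  = refl

lemma4p5 : (M : Matroid) (n c : ℕ) → 1 ≤ c
    → (part : Fin (Matroid.size M) → Label n)
    → Is4cFlexipath M part c
    → 3 ≤ n → c ≤ 2
lemma4p5 M .(3 + m) c _ part (flexipath , conn-P , conn-P∪P) (s≤s (s≤s (s≤s {n = m} _))) =
  c+c<6⇒c≤2 c (begin-strict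
    c + c
      <⟨ +-mono-<-≤ (conn-P∪P (# 0) (# 1) (λ ())) (≤-reflexive (sym (conn-P (# 2)))) ⟩
    conn M (P (# 0) ∪ P (# 1)) + conn M (P (# 2))
      ≡⟨ cong₂ (λ A B → conn M A + conn M B) L∪P₀∪P₁∖L∪P₂ L∪P₂∖L∪P₀∪P₁ ⟨
    conn M (L∪P₀∪P₁ ∩ ∁ L∪P₂) + conn M (L∪P₂ ∩ ∁ L∪P₀∪P₁)
      ≤⟨ conn-posimodular L∪P₀∪P₁ L∪P₂ ⟩
    conn M L∪P₀∪P₁ + conn M L∪P₂
      ≡⟨ cong₂ _+_ (proj₂ (flexipath id) 2 (s≤s (s≤s z≤n)))
                   (proj₂ (flexipath (transpose (# 0) (# 2))) 1 (s≤s z≤n)) ⟩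
    3 + 3 ∎)
  where
  open Connectivity M
  open FirstThreeBlocks M part
  open ≤-Reasoning
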